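{- Let $G$ and $H$ be two graphs of order $n$ and $n'$, respectively. If neither $G$ nor $H$ has true twin vertices, ($D(G)\le 2$ or neither $G$ nor $H$ has isolated vertices), and the complement of $G$ is a $\mathcal{C}$-graph, then $\dim_s(G\oplus H)=nn'-\omega(G)\omega(H)$.
   Context: All graphs are finite and simple. Two vertices $x,y$ are true twins if $N_G[x]=N_G[y]$. The Cartesian sum $G\oplus H$ of $G=(V_1,E_1)$ and $H=(V_2,E_2)$ has vertex set $V_1\times V_2$, with $(a,b)(c,d)$ an edge iff $ac\in E_1$ or $bd\in E_2$. $D(G)$ is the diameter (infinite if $G$ is disconnected). $\omega(G)$ is the clique number and $\alpha(G)$ the independence number. A $\mathcal{C}$-graph is a graph $G$ whose vertex set can be partitioned into $\alpha(G)$ cliques. For a connected graph $G$, a vertex $w$ strongly resolves $u,v$ if $d_G(w,u)=d_G(w,v)+d_G(v,u)$ or $d_G(w,v)=d_G(w,u)+d_G(u,v)$; $\dim_s(G)$ is the minimum cardinality of a set $S$ such that every pair of vertices is strongly resolved by some vertex of $S$. -}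

module Defs where

open import Data.Nat using (ℕ; zero; suc; _+_; _*_; _∸_; _≤_)
open import Data.Bool using (Bool; true; false; _∨_)
open import Data.Fin using (Fin; remQuot)
open import Data.Fin.Subset using (Subset; _∈_; ∣_∣)
open import Data.Product using (Σ; Σ-syntax; ∃; ∃-syntax; _×_; _,_; proj₁; proj₂)
open import Data.Sum using (_⊎_)
open import Relation.Nullary using (¬_)
open import Relation.Binary.PropositionalEquality using (_≡_; _≢_)
open import Function.Bundles using (_⇔_)

record Graph (n : ℕ) : Set where
  field
    adj     : Fin n → Fin n → Bool
    adj-sym : ∀ u v → adj u v ≡ adj v u
    irrefl  : ∀ u → adj u u ≡ false
open Graph public

module _ {n : ℕ} (G : Graph n) where

  data Walk : Fin n → Fin n → ℕ → Set where
    here : ∀ {u} → Walk u u zero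
    step : ∀ {u v w k} → adj G u v ≡ true → Walk v w k → Walk u w (suc k)

  -- d_G(u,v) = k  (only holds when u,v are connected)
  Dist : Fin n → Fin n → ℕ → Set
  Dist u v k = Walk u v k × (∀ j → Walk u v j → k ≤ j)

  -- D(G) ≤ 2 (diameter infinite if disconnected)
  DiamAtMost2 : Set
  DiamAtMost2 = ∀ u v → ∃[ k ] (k ≤ 2 × Dist u v k)

  InClosedNbhd : Fin n → Fin n → Set
  InClosedNbhd x z = z ≡ x ⊎ adj G x z ≡ true

  NoTrueTwins : Set
  NoTrueTwins = ∀ x y → x ≢ y → ¬ (∀ z → InClosedNbhd x z ⇔ InClosedNbhd y z)

  NoIsolated : Set
  NoIsolated = ∀ u → ∃[ v ] (adj G u v ≡ true)

  IsClique : Subset n → Set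
  IsClique S = ∀ u v → u ∈ S → v ∈ S → u ≢ v → adj G u v ≡ true

  IsIndependent : Subset n → Set
  IsIndependent S = ∀ u v → u ∈ S → v ∈ S → u ≢ v → adj G u v ≡ false

  IsCliqueNumber : ℕ → Set
  IsCliqueNumber w = (∃[ S ] (IsClique S × ∣ S ∣ ≡ w)) × (∀ S → IsClique S → ∣ S ∣ ≤ w)

  IsIndepNumber : ℕ → Set
  IsIndepNumber a = (∃[ S ] (IsIndependent S × ∣ S ∣ ≡ a)) × (∀ S → IsIndependent S → ∣ S ∣ ≤ a)

  -- G is a C-graph: V(G) partitioned into α(G) cliques (parts indexed by Fin α, all nonempty)
  IsCGraph : Set
  IsCGraph = ∃[ a ] (IsIndepNumber a ×
               Σ (Fin n → Fin a) λ c → ((∀ (i : Fin a) → ∃[ u ] (c u ≡ i)) ×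
                       (∀ u v → u ≢ v → c u ≡ c v → adj G u v ≡ true)))

  StronglyResolves : Fin n → Fin n → Fin n → Set
  StronglyResolves w u v =
    ∃[ a ] ∃[ b ] ∃[ c ] (Dist w u a × Dist w v b × Dist u v c ×
                          (a ≡ b + c ⊎ b ≡ a + c))

  IsStrongResolvingSet : Subset n → Set
  IsStrongResolvingSet S = ∀ u v → u ≢ v → ∃[ w ] (w ∈ S × StronglyResolves w u v)

  IsStrongMetricDim : ℕ → Set
  IsStrongMetricDim m =
    (∃[ S ] (IsStrongResolvingSet S × ∣ S ∣ ≡ m)) ×
    (∀ S → IsStrongResolvingSet S → m ≤ ∣ S ∣)

complement : ∀ {n} → Graph n → Graph n
complement {n} G = record { adj = λ u v → not' u v ; adj-sym = sy ; irrefl = ir }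
  where
  open import Data.Bool using (not)
  open import Relation.Nullary using (does)
  open import Data.Fin using (_≟_)
  open import Relation.Binary.PropositionalEquality using (refl; cong; cong₂; sym)
  not' : Fin n → Fin n → Bool
  not' u v = not (does (u ≟ v) ∨ adj G u v)
  eqsym : ∀ u v → does (u ≟ v) ≡ does (v ≟ u)
  eqsym u v with u ≟ v | v ≟ u
  ... | Relation.Nullary.yes _ | Relation.Nullary.yes _ = refl
  ... | Relation.Nullary.no _  | Relation.Nullary.no _  = refl
  ... | Relation.Nullary.yes p | Relation.Nullary.no q  = Data.Empty.⊥-elim (q (sym p))
    where import Data.Empty
  ... | Relation.Nullary.no q  | Relation.Nullary.yes p = Data.Empty.⊥-elim (q (sym p))
    where import Data.Empty
  sy : ∀ u v → not' u v ≡ not' v u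
  sy u v = cong not (cong₂ _∨_ (eqsym u v) (adj-sym G u v))
  ir : ∀ u → not' u u ≡ false
  ir u with u ≟ u
  ... | Relation.Nullary.yes _ = refl
  ... | Relation.Nullary.no q = Data.Empty.⊥-elim (q refl)
    where import Data.Empty

-- Cartesian sum G ⊕ H on Fin (n * n'), vertex i ↔ remQuot {n} n' i = (a , b):
-- (a,b)(c,d) edge iff ac ∈ E(G) or bd ∈ E(H)
_⊕_ : ∀ {n n'} → Graph n → Graph n' → Graph (n * n')
_⊕_ {n} {n'} G H = record { adj = ad ; adj-sym = sy ; irrefl = ir }
  where
  open import Relation.Binary.PropositionalEquality using (cong₂; trans)
  ad : Fin (n * n') → Fin (n * n') → Bool
  ad i j = adj G (proj₁ (remQuot {n} n' i)) (proj₁ (remQuot {n} n' j))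
         ∨ adj H (proj₂ (remQuot {n} n' i)) (proj₂ (remQuot {n} n' j))
  sy : ∀ i j → ad i j ≡ ad j i
  sy i j = cong₂ _∨_ (adj-sym G _ _) (adj-sym H _ _)
  ir : ∀ i → ad i i ≡ false
  ir i = trans (cong₂ _∨_ (irrefl G _) (irrefl H _)) Relation.Binary.PropositionalEquality.refl

-- In a graph of diameter at most 2, two non-adjacent vertices are at distance 2 while every
-- third vertex is at distance 1 or 2 from both, so no third vertex strongly resolves them: the
-- complement of a strong resolving set is a clique. Conversely, without true twins every
-- pair inside a clique C is separated by a vertex outside C, which makes the complement of C
-- strongly resolving. Hence dim_s = n − ω for twin-free graphs of diameter at most 2.
-- The hypotheses make G ⊕ H such a graph, and ω(G ⊕ H) = ω(G) ω(H): the partition of the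
-- complement into α(Ḡ) cliques is a proper colouring of G with α(Ḡ) ≤ ω(G) colours, a clique of
-- G ⊕ H maps injectively to (colour, H-vertex) pairs, and the H-vertices used by one colour form
-- a clique of H.
module Submission where

open import Level using (Level)
open import Function using (_∘_)
open import Function.Bundles using (Equivalence; mk⇔; _⇔_)
open import Data.Empty using (⊥-elim)
open import Data.Nat using (ℕ; zero; suc; _+_; _*_; _∸_; _≤_; z≤n; s≤s)
open import Data.Nat.Properties
  using ( ≤-trans; ≤-antisym; +-comm; +-mono-≤; +-monoˡ-≤; +-monoʳ-≤; *-monoˡ-≤; m+[n∸m]≡n
        ; m≤n+o⇒m∸n≤o; module ≤-Reasoning)
open import Data.Bool using (true; false; _∧_; _∨_; not)
import Data.Bool as Bool
open import Data.Bool.Properties using (∧-conicalˡ; ∧-conicalʳ; ∨-conicalˡ; ∨-zeroʳ; not-¬; ¬-not; not-injective)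
open import Data.Fin using (Fin; zero; suc; combine; remQuot)
import Data.Fin as Fin
open import Data.Fin.Properties
  using (any?; suc-injective; 0≢1+n; combine-remQuot; remQuot-combine; combine-injectiveˡ; combine-injectiveʳ)
open import Data.Fin.Subset using (Subset; _∈_; _∉_; ∣_∣; ∁; _-_)
open import Data.Fin.Subset.Properties
  using (_∈?_; x∉p⇒x∈∁p; x∈∁p⇒x∉p; x∈p∧x≢y⇒x∈p-y; x∈p⇒∣p-x∣<∣p∣; ∣∁p∣≡n∸∣p∣; ∣p∣≤n)
open import Data.Vec using (Vec; []; _∷_; _++_; concat; map; lookup; tabulate; _⊛*_; here; there)
open import Data.Vec.Properties
  using (lookup-map; lookup-⊛*; lookup-concat; lookup∘tabulate; []=⇒lookup; lookup⇒[]=; map-id)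
open import Data.Product using (∃-syntax; _×_; _,_; proj₁; proj₂)
open import Data.Sum using (_⊎_; inj₁; inj₂; swap; [_,_]′)
import Data.Sum as Sum
open import Relation.Nullary using (Dec; yes; no; does; ¬_; ¬?; _×-dec_; _⊎-dec_)
open import Relation.Nullary.Decidable using (dec-true; decidable-stable)
open import Relation.Unary using (Pred; Decidable)
open import Relation.Binary.PropositionalEquality

open import Defs

private variable
  m k : ℕ
  ℓ : Level

∣p++q∣≡∣p∣+∣q∣ : (p : Subset m) (q : Subset k) → ∣ p ++ q ∣ ≡ ∣ p ∣ + ∣ q ∣
∣p++q∣≡∣p∣+∣q∣ []          q = refl
∣p++q∣≡∣p∣+∣q∣ (true ∷ p)  q = cong suc (∣p++q∣≡∣p∣+∣q∣ p q)
∣p++q∣≡∣p∣+∣q∣ (false ∷ p) q = ∣p++q∣≡∣p∣+∣q∣ p q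

∣concat∣≤ : ∀ w (ps : Vec (Subset k) m) → (∀ i → ∣ lookup ps i ∣ ≤ w) → ∣ concat ps ∣ ≤ m * w
∣concat∣≤ w []       bound = z≤n
∣concat∣≤ {m = suc m} w (p ∷ ps) bound = begin
  ∣ p ++ concat ps ∣        ≡⟨ ∣p++q∣≡∣p∣+∣q∣ p (concat ps) ⟩
  ∣ p ∣ + ∣ concat ps ∣     ≤⟨ +-mono-≤ (bound zero) (∣concat∣≤ w ps (bound ∘ suc)) ⟩
  w + m * w                 ∎
  where open ≤-Reasoning

_⊗_ : Subset m → Subset k → Subset (m * k)
p ⊗ q = map _∧_ p ⊛* q

∣p⊗q∣≡∣p∣*∣q∣ : (p : Subset m) (q : Subset k) → ∣ p ⊗ q ∣ ≡ ∣ p ∣ * ∣ q ∣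
∣p⊗q∣≡∣p∣*∣q∣ [] q = refl
∣p⊗q∣≡∣p∣*∣q∣ (true ∷ p) q = begin
  ∣ map (true ∧_) q ++ p ⊗ q ∣        ≡⟨ ∣p++q∣≡∣p∣+∣q∣ (map (true ∧_) q) (p ⊗ q) ⟩
  (∣ map (true ∧_) q ∣) + (∣ p ⊗ q ∣) ≡⟨ cong₂ _+_ (cong ∣_∣ (map-id q)) (∣p⊗q∣≡∣p∣*∣q∣ p q) ⟩
  (∣ q ∣) + (∣ p ∣) * (∣ q ∣)         ∎
  where open ≡-Reasoning
∣p⊗q∣≡∣p∣*∣q∣ (false ∷ p) q = begin
  ∣ map (false ∧_) q ++ p ⊗ q ∣        ≡⟨ ∣p++q∣≡∣p∣+∣q∣ (map (false ∧_) q) (p ⊗ q) ⟩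
  (∣ map (false ∧_) q ∣) + (∣ p ⊗ q ∣) ≡⟨ cong₂ _+_ (∣map[false∧]q∣ q) (∣p⊗q∣≡∣p∣*∣q∣ p q) ⟩
  (∣ p ∣) * (∣ q ∣)                    ∎
  where
  open ≡-Reasoning
  ∣map[false∧]q∣ : ∀ {k} (q : Subset k) → ∣ map (false ∧_) q ∣ ≡ 0
  ∣map[false∧]q∣ []      = refl
  ∣map[false∧]q∣ (_ ∷ q) = ∣map[false∧]q∣ q

lookup-⊗ : (p : Subset m) (q : Subset k) (x : Fin m) (y : Fin k) →
  lookup (p ⊗ q) (combine x y) ≡ lookup p x ∧ lookup q y
lookup-⊗ p q x y = trans (lookup-⊛* (map _∧_ p) q x y) (cong (λ f → f (lookup q y)) (lookup-map x _∧_ p))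

∈-⊗⁻ : {p : Subset m} {q : Subset k} (i : Fin (m * k)) → i ∈ p ⊗ q →
  proj₁ (remQuot {m} k i) ∈ p × proj₂ (remQuot {m} k i) ∈ q
∈-⊗⁻ {m} {k} {p} {q} i i∈p⊗q =
  lookup⇒[]= x p (∧-conicalˡ _ _ p∧q) , lookup⇒[]= y q (∧-conicalʳ _ _ p∧q)
  where
  x : Fin m
  x = proj₁ (remQuot {m} k i)
  y : Fin k
  y = proj₂ (remQuot {m} k i)
  p∧q : lookup p x ∧ lookup q y ≡ true
  p∧q = trans (sym (lookup-⊗ p q x y))
              (trans (cong (lookup (p ⊗ q)) (combine-remQuot {m} k i)) ([]=⇒lookup i∈p⊗q))

∈-concat⁺ : (ps : Vec (Subset k) m) {x : Fin m} {y : Fin k} → y ∈ lookup ps x → combine x y ∈ concat ps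
∈-concat⁺ ps {x} {y} y∈ = lookup⇒[]= (combine x y) (concat ps) (trans (lookup-concat ps x y) ([]=⇒lookup y∈))

subsetOf : {P : Pred (Fin m) ℓ} → Decidable P → Subset m
subsetOf P? = tabulate (does ∘ P?)

∈-subsetOf⁺ : {P : Pred (Fin m) ℓ} (P? : Decidable P) {x : Fin m} → P x → x ∈ subsetOf P?
∈-subsetOf⁺ P? {x} px = lookup⇒[]= x _ (trans (lookup∘tabulate _ x) (dec-true (P? x) px))

∈-subsetOf⁻ : {P : Pred (Fin m) ℓ} (P? : Decidable P) {x : Fin m} → x ∈ subsetOf P? → P x
∈-subsetOf⁻ P? {x} x∈ with P? x | trans (sym (lookup∘tabulate _ x)) ([]=⇒lookup x∈)
... | yes px | _ = px

∣p∣≤∣q∣-injective : {p : Subset m} {q : Subset k} (f : Fin m → Fin k) →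
  (∀ {x} → x ∈ p → f x ∈ q) → (∀ {x y} → x ∈ p → y ∈ p → f x ≡ f y → x ≡ y) → ∣ p ∣ ≤ ∣ q ∣
∣p∣≤∣q∣-injective {p = []} f into inj = z≤n
∣p∣≤∣q∣-injective {p = false ∷ p} f into inj =
  ∣p∣≤∣q∣-injective (f ∘ suc) (into ∘ there) (λ x∈p y∈p eq → suc-injective (inj (there x∈p) (there y∈p) eq))
∣p∣≤∣q∣-injective {p = true ∷ p} {q} f into inj =
  ≤-trans (s≤s (∣p∣≤∣q∣-injective {q = q - f zero} (f ∘ suc) into′ inj′)) (x∈p⇒∣p-x∣<∣p∣ (into here))
  where
  inj′ : ∀ {x y} → x ∈ p → y ∈ p → f (suc x) ≡ f (suc y) → x ≡ y
  inj′ x∈p y∈p eq = suc-injective (inj (there x∈p) (there y∈p) eq)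
  into′ : ∀ {x} → x ∈ p → f (suc x) ∈ q - f zero
  into′ x∈p = x∈p∧x≢y⇒x∈p-y (into (there x∈p)) (λ eq → 0≢1+n (inj here (there x∈p) (sym eq)))

∣p∣+∣∁p∣≡n : (p : Subset m) → ∣ p ∣ + ∣ ∁ p ∣ ≡ m
∣p∣+∣∁p∣≡n p = trans (cong (∣ p ∣ +_) (∣∁p∣≡n∸∣p∣ p)) (m+[n∸m]≡n (∣p∣≤n p))

x≤2∧1≤y⇒x≢y+2 : ∀ {x y} → x ≤ 2 → 1 ≤ y → x ≢ y + 2
x≤2∧1≤y⇒x≢y+2 x≤2 1≤y refl with ≤-trans (+-monoˡ-≤ 2 1≤y) x≤2
... | s≤s (s≤s ())

module _ {m : ℕ} (K : Graph m) where

  private variable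
    u v w z : Fin m
    d : ℕ

  adjacent-sym : adj K u v ≡ true → adj K v u ≡ true
  adjacent-sym {u} {v} uv = trans (adj-sym K v u) uv

  adjacent⇒≢ : adj K u v ≡ true → u ≢ v
  adjacent⇒≢ {u} uv refl = not-¬ uv (irrefl K u)

  Walk-snoc : ∀ {k} → Walk K u v k → adj K v w ≡ true → Walk K u w (suc k)
  Walk-snoc here       vw = step vw here
  Walk-snoc (step e p) vw = step e (Walk-snoc p vw)

  Walk-reverse : ∀ {k} → Walk K u v k → Walk K v u k
  Walk-reverse here       = here
  Walk-reverse (step e p) = Walk-snoc (Walk-reverse p) (adjacent-sym e)

  Dist-sym : Dist K u v d → Dist K v u d
  Dist-sym (p , shortest) = Walk-reverse p , λ j q → shortest j (Walk-reverse q)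

  Dist-unique : ∀ {d′} → Dist K u v d → Dist K u v d′ → d ≡ d′
  Dist-unique (p , shortest) (p′ , shortest′) = ≤-antisym (shortest _ p′) (shortest′ _ p)

  Dist-refl : Dist K u u 0
  Dist-refl = here , λ _ _ → z≤n

  Dist-≢ : u ≢ v → Dist K u v d → 1 ≤ d
  Dist-≢ u≢v (here , _)       = ⊥-elim (u≢v refl)
  Dist-≢ u≢v (step _ _ , _)   = s≤s z≤n

  Dist-adjacent : adj K u v ≡ true → Dist K u v 1
  Dist-adjacent uv = step uv here , shortest
    where
    shortest : ∀ j → Walk K _ _ j → 1 ≤ j
    shortest zero    here = ⊥-elim (adjacent⇒≢ uv refl)
    shortest (suc j) _    = s≤s z≤n

  Dist-common-neighbour : u ≢ v → adj K u v ≡ false → adj K u z ≡ true → adj K z v ≡ true → Dist K u v 2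
  Dist-common-neighbour u≢v ¬uv uz zv = step uz (step zv here) , shortest
    where
    shortest : ∀ j → Walk K _ _ j → 2 ≤ j
    shortest zero          here              = ⊥-elim (u≢v refl)
    shortest (suc zero)    (step uv here)    = ⊥-elim (not-¬ uv ¬uv)
    shortest (suc (suc j)) _                 = s≤s (s≤s z≤n)

  Diameter≤2 : Set
  Diameter≤2 = ∀ u v → u ≢ v → adj K u v ≡ false → ∃[ z ] (adj K u z ≡ true × adj K z v ≡ true)

  Diameter≤2⇒Dist : Diameter≤2 → u ≢ v → ∃[ d ] Dist K u v d
  Diameter≤2⇒Dist {u} {v} diam u≢v with adj K u v in uv
  ... | true  = 1 , Dist-adjacent uv
  ... | false with diam u v u≢v uv
  ... | z , uz , zv = 2 , Dist-common-neighbour u≢v uv uz zv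

  Diameter≤2⇒Dist≤2 : Diameter≤2 → Dist K u v d → d ≤ 2
  Diameter≤2⇒Dist≤2 {u} {v} diam (_ , shortest) with u Fin.≟ v | adj K u v in uv
  ... | yes refl | _     = ≤-trans (shortest 0 here) z≤n
  ... | no _     | true  = ≤-trans (shortest 1 (step uv here)) (s≤s z≤n)
  ... | no u≢v   | false with diam u v u≢v uv
  ... | z , uz , zv = shortest 2 (step uz (step zv here))

  DiamAtMost2⇒Diameter≤2 : DiamAtMost2 K → Diameter≤2
  DiamAtMost2⇒Diameter≤2 diam u v u≢v ¬uv with diam u v
  ... | _ , _          , here                    , _ = ⊥-elim (u≢v refl)
  ... | _ , _          , step uv here            , _ = ⊥-elim (not-¬ uv ¬uv)
  ... | _ , _          , step uz (step zv here)  , _ = _ , uz , zv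
  ... | _ , s≤s (s≤s ()) , step _ (step _ (step _ _)) , _

  Walk-first-step : ∀ {k} → u ≢ v → Walk K u v k → ∃[ z ] (adj K u z ≡ true)
  Walk-first-step u≢v here       = ⊥-elim (u≢v refl)
  Walk-first-step _   (step e _) = _ , e

  DiamAtMost2⇒NoIsolated : 2 ≤ m → DiamAtMost2 K → NoIsolated K
  DiamAtMost2⇒NoIsolated (s≤s (s≤s _)) diam u =
    let (_ , _ , walk , _) = diam u (other u) in Walk-first-step (other-≢ u) walk
    where
    other : ∀ {k} → Fin (suc (suc k)) → Fin (suc (suc k))
    other zero    = suc zero
    other (suc _) = zero
    other-≢ : ∀ {k} (x : Fin (suc (suc k))) → x ≢ other x
    other-≢ zero    ()
    other-≢ (suc _) ()

  -- d(u,v) = 2, and d(w,u), d(w,v) ∈ {1,2}, so neither d(w,u) = d(w,v) + 2 nor the converse holds.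
  non-adjacent-unresolvable : Diameter≤2 → u ≢ v → adj K u v ≡ false → w ≢ u → w ≢ v →
    ¬ StronglyResolves K w u v
  non-adjacent-unresolvable {u} {v} diam u≢v ¬uv w≢u w≢v (a , b , c , wu , wv , uv , sum)
    with diam u v u≢v ¬uv
  ... | z , uz , zv rewrite Dist-unique uv (Dist-common-neighbour u≢v ¬uv uz zv) with sum
  ... | inj₁ a≡b+2 = x≤2∧1≤y⇒x≢y+2 (Diameter≤2⇒Dist≤2 diam wu) (Dist-≢ w≢v wv) a≡b+2
  ... | inj₂ b≡a+2 = x≤2∧1≤y⇒x≢y+2 (Diameter≤2⇒Dist≤2 diam wv) (Dist-≢ w≢u wu) b≡a+2

  InClosedNbhd? : ∀ x z → Dec (InClosedNbhd K x z)
  InClosedNbhd? x z = z Fin.≟ x ⊎-dec adj K x z Bool.≟ true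

  Separates : Fin m → Fin m → Fin m → Set
  Separates u v z = InClosedNbhd K u z × ¬ InClosedNbhd K v z

  Separable : Fin m → Fin m → Set
  Separable u v = ∃[ z ] (Separates u v z ⊎ Separates v u z)

  NoTrueTwins⇒Separable : NoTrueTwins K → u ≢ v → Separable u v
  NoTrueTwins⇒Separable {u} {v} twinFree u≢v with any? separates?
    where
    separates? : ∀ z → Dec (Separates u v z ⊎ Separates v u z)
    separates? z = (InClosedNbhd? u z ×-dec ¬? (InClosedNbhd? v z)) ⊎-dec
                   (InClosedNbhd? v z ×-dec ¬? (InClosedNbhd? u z))
  ... | yes separable = separable
  ... | no ¬separable = ⊥-elim (twinFree u v u≢v λ z → mk⇔ (onlyIn z inj₁) (onlyIn z inj₂))
    where
    onlyIn : ∀ {x y} z → (Separates x y z → Separates u v z ⊎ Separates v u z) →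
             InClosedNbhd K x z → InClosedNbhd K y z
    onlyIn {y = y} z sep xz = decidable-stable (InClosedNbhd? y z) (λ ¬yz → ¬separable (z , sep (xz , ¬yz)))

  Separable⇒¬twins : Separable u v → ¬ (∀ z → InClosedNbhd K u z ⇔ InClosedNbhd K v z)
  Separable⇒¬twins (z , inj₁ (uz , ¬vz)) twins = ¬vz (Equivalence.to (twins z) uz)
  Separable⇒¬twins (z , inj₂ (vz , ¬uz)) twins = ¬uz (Equivalence.from (twins z) vz)

  non-adjacent⇒Separable : u ≢ v → adj K u v ≡ false → Separable u v
  non-adjacent⇒Separable {u} {v} u≢v ¬uv = u , inj₁ (inj₁ refl , u∉N[v])
    where
    u∉N[v] : ¬ InClosedNbhd K v u
    u∉N[v] (inj₁ u≡v) = u≢v u≡v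
    u∉N[v] (inj₂ vu)  = not-¬ (adjacent-sym vu) ¬uv

  adjacent-Separable⇒NoTrueTwins : (∀ {u v} → adj K u v ≡ true → Separable u v) → NoTrueTwins K
  adjacent-Separable⇒NoTrueTwins separable u v u≢v with adj K u v in uv
  ... | true  = Separable⇒¬twins (separable uv)
  ... | false = Separable⇒¬twins (non-adjacent⇒Separable u≢v uv)

  separates-adjacent : adj K u v ≡ true → Separates u v z → adj K u z ≡ true × adj K v z ≡ false × z ≢ v
  separates-adjacent uv (inj₁ refl , ¬vz) = ⊥-elim (¬vz (inj₂ (adjacent-sym uv)))
  separates-adjacent uv (inj₂ uz , ¬vz)    = uz , ¬-not (¬vz ∘ inj₂) , ¬vz ∘ inj₁

  StronglyResolves-sym : StronglyResolves K w u v → StronglyResolves K w v u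
  StronglyResolves-sym (a , b , c , wu , wv , uv , sum) = b , a , c , wv , wu , Dist-sym uv , swap sum

  StronglyResolves-self : Dist K u v d → StronglyResolves K u u v
  StronglyResolves-self {d = d} uv = 0 , d , d , Dist-refl , uv , uv , inj₂ refl

  separator-resolves : adj K u v ≡ true → Separates u v z → StronglyResolves K z u v
  separator-resolves uv sep with separates-adjacent uv sep
  ... | uz , ¬vz , z≢v = 1 , 2 , 1 , Dist-adjacent (adjacent-sym uz) ,
    Dist-common-neighbour z≢v (trans (adj-sym K _ _) ¬vz) (adjacent-sym uz) uv , Dist-adjacent uv , inj₂ refl

  separator∉clique : {C : Subset m} → IsClique K C → v ∈ C → ¬ InClosedNbhd K v z → z ∉ C
  separator∉clique {v} {z} clique v∈C ¬vz z∈C with z Fin.≟ v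
  ... | yes z≡v = ¬vz (inj₁ z≡v)
  ... | no z≢v  = ¬vz (inj₂ (clique v z v∈C z∈C (z≢v ∘ sym)))

  ∁clique-stronglyResolving : Diameter≤2 → NoTrueTwins K → {C : Subset m} → IsClique K C →
    IsStrongResolvingSet K (∁ C)
  ∁clique-stronglyResolving diam twinFree {C} clique u v u≢v with u ∈? C | v ∈? C
  ... | no u∉C | _ = u , x∉p⇒x∈∁p u∉C , StronglyResolves-self (proj₂ (Diameter≤2⇒Dist diam u≢v))
  ... | yes _ | no v∉C = v , x∉p⇒x∈∁p v∉C ,
    StronglyResolves-sym (StronglyResolves-self (proj₂ (Diameter≤2⇒Dist diam (u≢v ∘ sym))))
  ... | yes u∈C | yes v∈C with NoTrueTwins⇒Separable twinFree u≢v
  ... | z , inj₁ sep = z , x∉p⇒x∈∁p (separator∉clique clique v∈C (proj₂ sep)) ,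
    separator-resolves (clique u v u∈C v∈C u≢v) sep
  ... | z , inj₂ sep = z , x∉p⇒x∈∁p (separator∉clique clique u∈C (proj₂ sep)) ,
    StronglyResolves-sym (separator-resolves (clique v u v∈C u∈C (u≢v ∘ sym)) sep)

  stronglyResolving⇒∁clique : Diameter≤2 → {S : Subset m} → IsStrongResolvingSet K S → IsClique K (∁ S)
  stronglyResolving⇒∁clique diam resolving u v u∈∁S v∈∁S u≢v with adj K u v in uv
  ... | true = refl
  ... | false with resolving u v u≢v
  ... | w , w∈S , resolves = ⊥-elim (non-adjacent-unresolvable diam u≢v uv
          (λ { refl → x∈∁p⇒x∉p u∈∁S w∈S }) (λ { refl → x∈∁p⇒x∉p v∈∁S w∈S }) resolves)

  strongMetricDim-Diameter≤2 : Diameter≤2 → NoTrueTwins K → ∀ {ω} → IsCliqueNumber K ω →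
    IsStrongMetricDim K (m ∸ ω)
  strongMetricDim-Diameter≤2 diam twinFree {ω} ((C , clique , ∣C∣≡ω) , maximum) =
    (∁ C , ∁clique-stronglyResolving diam twinFree clique , trans (∣∁p∣≡n∸∣p∣ C) (cong (m ∸_) ∣C∣≡ω)) ,
    λ S resolving → m≤n+o⇒m∸n≤o m ω (begin
      m               ≡⟨ ∣p∣+∣∁p∣≡n S ⟨
      ∣ S ∣ + ∣ ∁ S ∣ ≤⟨ +-monoʳ-≤ ∣ S ∣ (maximum (∁ S) (stronglyResolving⇒∁clique diam resolving)) ⟩
      ∣ S ∣ + ω       ≡⟨ +-comm ∣ S ∣ ω ⟩
      ω + ∣ S ∣       ∎)
    where open ≤-Reasoning

IsProperColouring : ∀ {m a} → Graph m → (Fin m → Fin a) → Set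
IsProperColouring G c = ∀ u v → c u ≡ c v → adj G u v ≡ false

module _ {m : ℕ} (G : Graph m) where

  adj-complement : {u v : Fin m} → u ≢ v → adj (complement G) u v ≡ not (adj G u v)
  adj-complement {u} {v} u≢v with u Fin.≟ v
  ... | yes u≡v = ⊥-elim (u≢v u≡v)
  ... | no _    = refl

  complement-CGraph⇒colouring : IsCGraph (complement G) → ∀ {w} → IsCliqueNumber G w →
    ∃[ a ] (a ≤ w × ∃[ c ] IsProperColouring {a = a} G c)
  complement-CGraph⇒colouring (a , ((S , independent , ∣S∣≡a) , _) , c , _ , classes-cliques) (_ , maximum) =
    a , subst (_≤ _) ∣S∣≡a (maximum S clique) , c , proper
    where
    clique : IsClique G S
    clique u v u∈S v∈S u≢v = not-injective (trans (sym (adj-complement u≢v)) (independent u v u∈S v∈S u≢v))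
    proper : IsProperColouring G c
    proper u v cu≡cv with u Fin.≟ v
    ... | yes refl = irrefl G u
    ... | no u≢v   = not-injective (trans (sym (adj-complement u≢v)) (classes-cliques u v u≢v cu≡cv))

module _ {n n′ : ℕ} (G : Graph n) (H : Graph n′) where

  private variable
    i j : Fin (n * n′)
    x x′ : Fin n
    y y′ : Fin n′

  π₁ : Fin (n * n′) → Fin n
  π₁ i = proj₁ (remQuot {n} n′ i)

  π₂ : Fin (n * n′) → Fin n′
  π₂ i = proj₂ (remQuot {n} n′ i)

  π₁-combine : π₁ (combine x y) ≡ x
  π₁-combine {x} {y} = cong proj₁ (remQuot-combine x y)

  π₂-combine : π₂ (combine x y) ≡ y
  π₂-combine {x} {y} = cong proj₂ (remQuot-combine x y)

  π-injective : π₁ i ≡ π₁ j → π₂ i ≡ π₂ j → i ≡ j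
  π-injective {i} {j} eq₁ eq₂ =
    trans (sym (combine-remQuot {n} n′ i)) (trans (cong₂ combine eq₁ eq₂) (combine-remQuot {n} n′ j))

  ⊕-adj-combine : adj (G ⊕ H) i (combine x y) ≡ adj G (π₁ i) x ∨ adj H (π₂ i) y
  ⊕-adj-combine = cong₂ (λ x y → adj G _ x ∨ adj H _ y) π₁-combine π₂-combine

  ⊕-adj-combine₂ : adj (G ⊕ H) (combine x y) (combine x′ y′) ≡ adj G x x′ ∨ adj H y y′
  ⊕-adj-combine₂ = trans ⊕-adj-combine (cong₂ (λ x y → adj G x _ ∨ adj H y _) π₁-combine π₂-combine)

  ⊕-adjacentˡ : adj G (π₁ i) x ≡ true → adj (G ⊕ H) i (combine x y) ≡ true
  ⊕-adjacentˡ {i} {x} {y} ix = trans ⊕-adj-combine (cong (_∨ adj H (π₂ i) y) ix)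

  ⊕-adjacentʳ : adj H (π₂ i) y ≡ true → adj (G ⊕ H) i (combine x y) ≡ true
  ⊕-adjacentʳ {i} {y} {x} iy = trans ⊕-adj-combine (trans (cong (adj G (π₁ i) x ∨_) iy) (∨-zeroʳ _))

  ⊕-Diameter≤2 : NoIsolated G → Diameter≤2 G ⊎ NoIsolated H → Diameter≤2 (G ⊕ H)
  ⊕-Diameter≤2 noIsolatedG (inj₂ noIsolatedH) u v _ _ =
    let (x , ux) = noIsolatedG (π₁ u) ; (y , vy) = noIsolatedH (π₂ v)
    in combine x y , ⊕-adjacentˡ ux , adjacent-sym (G ⊕ H) (⊕-adjacentʳ vy)
  ⊕-Diameter≤2 noIsolatedG (inj₁ diamG) u v u≢v ¬uv with π₁ u Fin.≟ π₁ v
  ... | yes u₁≡v₁ =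
    let (x , ux) = noIsolatedG (π₁ u)
    in combine x (π₂ u) , ⊕-adjacentˡ ux ,
       adjacent-sym (G ⊕ H) (⊕-adjacentˡ (subst (λ v₁ → adj G v₁ x ≡ true) u₁≡v₁ ux))
  ... | no u₁≢v₁ =
    let (x , ux , xv) = diamG (π₁ u) (π₁ v) u₁≢v₁ (∨-conicalˡ _ _ ¬uv)
    in combine x (π₂ u) , ⊕-adjacentˡ ux , adjacent-sym (G ⊕ H) (⊕-adjacentˡ (adjacent-sym G xv))

  Separates-⊕ˡ : {u v : Fin (n * n′)} → adj G (π₁ u) (π₁ v) ≡ true →
    Separates G (π₁ u) (π₁ v) x → Separates (G ⊕ H) u v (combine x (π₂ v))
  Separates-⊕ˡ {x} {u} {v} uv sep with separates-adjacent G uv sep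
  ... | ux , ¬vx , x≢v₁ = inj₂ (⊕-adjacentˡ ux) , x∉N[v]
    where
    x∉N[v] : ¬ InClosedNbhd (G ⊕ H) v (combine x (π₂ v))
    x∉N[v] (inj₁ eq) = x≢v₁ (trans (sym π₁-combine) (cong π₁ eq))
    x∉N[v] (inj₂ vx) = not-¬ vx (trans ⊕-adj-combine (cong₂ _∨_ ¬vx (irrefl H (π₂ v))))

  Separates-⊕ʳ : {u v : Fin (n * n′)} → adj G (π₁ u) (π₁ v) ≡ false → adj H (π₂ u) (π₂ v) ≡ true →
    Separates H (π₂ u) (π₂ v) y → Separates (G ⊕ H) u v (combine (π₁ u) y)
  Separates-⊕ʳ {y} {u} {v} ¬uv₁ uv₂ sep with separates-adjacent H uv₂ sep
  ... | uy , ¬vy , y≢v₂ = inj₂ (⊕-adjacentʳ uy) , y∉N[v]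
    where
    y∉N[v] : ¬ InClosedNbhd (G ⊕ H) v (combine (π₁ u) y)
    y∉N[v] (inj₁ eq) = y≢v₂ (trans (sym π₂-combine) (cong π₂ eq))
    y∉N[v] (inj₂ vy) = not-¬ vy (trans ⊕-adj-combine (cong₂ _∨_ (trans (adj-sym G _ _) ¬uv₁) ¬vy))

  ⊕-adjacent⇒Separable : NoTrueTwins G → NoTrueTwins H → {u v : Fin (n * n′)} →
    adj (G ⊕ H) u v ≡ true → Separable (G ⊕ H) u v
  ⊕-adjacent⇒Separable twinFreeG twinFreeH {u} {v} uv with adj G (π₁ u) (π₁ v) in uv₁
  ... | true with NoTrueTwins⇒Separable G twinFreeG (adjacent⇒≢ G uv₁)
  ...   | _ , inj₁ sep = _ , inj₁ (Separates-⊕ˡ uv₁ sep)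
  ...   | _ , inj₂ sep = _ , inj₂ (Separates-⊕ˡ (adjacent-sym G uv₁) sep)
  ⊕-adjacent⇒Separable twinFreeG twinFreeH {u} {v} uv₂ | false
    with NoTrueTwins⇒Separable H twinFreeH (adjacent⇒≢ H uv₂)
  ...   | _ , inj₁ sep = _ , inj₁ (Separates-⊕ʳ uv₁ uv₂ sep)
  ...   | _ , inj₂ sep = _ , inj₂ (Separates-⊕ʳ (trans (adj-sym G _ _) uv₁) (adjacent-sym H uv₂) sep)

  ⊕-NoTrueTwins : NoTrueTwins G → NoTrueTwins H → NoTrueTwins (G ⊕ H)
  ⊕-NoTrueTwins twinFreeG twinFreeH =
    adjacent-Separable⇒NoTrueTwins (G ⊕ H) (⊕-adjacent⇒Separable twinFreeG twinFreeH)

  ⊗-clique : {p : Subset n} {q : Subset n′} → IsClique G p → IsClique H q → IsClique (G ⊕ H) (p ⊗ q)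
  ⊗-clique {p} {q} cliqueG cliqueH u v u∈ v∈ u≢v
    with ∈-⊗⁻ {p = p} {q} u u∈ | ∈-⊗⁻ {p = p} {q} v v∈ | π₁ u Fin.≟ π₁ v
  ... | u₁∈ , _   | v₁∈ , _   | no u₁≢v₁ = cong (_∨ _) (cliqueG _ _ u₁∈ v₁∈ u₁≢v₁)
  ... | _   , u₂∈ | _   , v₂∈ | yes u₁≡v₁ =
    trans (cong (_ ∨_) (cliqueH _ _ u₂∈ v₂∈ (u≢v ∘ π-injective u₁≡v₁))) (∨-zeroʳ _)

  module _ {a : ℕ} {c : Fin n → Fin a} (proper : IsProperColouring G c)
           {T : Subset (n * n′)} (clique : IsClique (G ⊕ H) T) where

    InColourShadow : Fin a → Fin n′ → Set
    InColourShadow k y = ∃[ x ] (c x ≡ k × combine x y ∈ T)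

    InColourShadow? : ∀ k → Decidable (InColourShadow k)
    InColourShadow? k y = any? (λ x → c x Fin.≟ k ×-dec combine x y ∈? T)

    colourShadow : Fin a → Subset n′
    colourShadow k = subsetOf (InColourShadow? k)

    colourShadow-clique : ∀ k → IsClique H (colourShadow k)
    colourShadow-clique k y y′ y∈ y′∈ y≢y′
      with ∈-subsetOf⁻ (InColourShadow? k) y∈ | ∈-subsetOf⁻ (InColourShadow? k) y′∈
    ... | x , cx≡k , xy∈T | x′ , cx′≡k , x′y′∈T =
      subst (λ b → b ∨ adj H y y′ ≡ true) (proper x x′ (trans cx≡k (sym cx′≡k)))
        (trans (sym ⊕-adj-combine₂) (clique _ _ xy∈T x′y′∈T (y≢y′ ∘ combine-injectiveʳ x y x′ y′)))

    ∈-colourShadow : i ∈ T → π₂ i ∈ colourShadow (c (π₁ i))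
    ∈-colourShadow {i} i∈T =
      ∈-subsetOf⁺ (InColourShadow? _) (π₁ i , refl , subst (_∈ T) (sym (combine-remQuot {n} n′ i)) i∈T)

    -- (x , y) ↦ (c x , y) is injective on the clique T, and its image has a clique of H in each colour.
    ⊕-clique-bound : ∀ {w′} → (∀ S → IsClique H S → ∣ S ∣ ≤ w′) → ∣ T ∣ ≤ a * w′
    ⊕-clique-bound {w′} maximumH =
      ≤-trans (∣p∣≤∣q∣-injective recolour into injective) (∣concat∣≤ w′ shadows bounded)
      where
      shadows : Vec (Subset n′) a
      shadows = tabulate colourShadow
      bounded : ∀ k → ∣ lookup shadows k ∣ ≤ w′
      bounded k rewrite lookup∘tabulate colourShadow k = maximumH _ (colourShadow-clique k)
      recolour : Fin (n * n′) → Fin (a * n′)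
      recolour i = combine (c (π₁ i)) (π₂ i)
      into : i ∈ T → recolour i ∈ concat shadows
      into {i} i∈T =
        ∈-concat⁺ shadows (subst (π₂ i ∈_) (sym (lookup∘tabulate colourShadow _)) (∈-colourShadow i∈T))
      injective : i ∈ T → j ∈ T → recolour i ≡ recolour j → i ≡ j
      injective {i} {j} i∈T j∈T eq with i Fin.≟ j
      ... | yes i≡j = i≡j
      ... | no i≢j  = ⊥-elim (not-¬ (clique i j i∈T j∈T i≢j) (cong₂ _∨_ (proper _ _ same-colour) ¬ij₂))
        where
        same-colour : c (π₁ i) ≡ c (π₁ j)
        same-colour = combine-injectiveˡ _ _ _ _ eq
        same-π₂ : π₂ i ≡ π₂ j
        same-π₂ = combine-injectiveʳ (c (π₁ i)) _ (c (π₁ j)) _ eq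
        ¬ij₂ : adj H (π₂ i) (π₂ j) ≡ false
        ¬ij₂ = subst (λ y → adj H (π₂ i) y ≡ false) same-π₂ (irrefl H (π₂ i))

  ⊕-cliqueNumber : ∀ {a} {c : Fin n → Fin a} → IsProperColouring G c → ∀ {w w′} → a ≤ w →
    IsCliqueNumber G w → IsCliqueNumber H w′ → IsCliqueNumber (G ⊕ H) (w * w′)
  ⊕-cliqueNumber {a} proper {w} {w′} a≤w ((KG , cliqueG , ∣KG∣≡w) , _) ((KH , cliqueH , ∣KH∣≡w′) , maximumH) =
    (KG ⊗ KH , ⊗-clique cliqueG cliqueH , trans (∣p⊗q∣≡∣p∣*∣q∣ KG KH) (cong₂ _*_ ∣KG∣≡w ∣KH∣≡w′)) ,
    λ T clique → ≤-trans (⊕-clique-bound proper clique maximumH) (*-monoˡ-≤ w′ a≤w)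

mainTheorem7 : ∀ {n n'} (G : Graph n) (H : Graph n') →
    2 ≤ n →
    NoTrueTwins G → NoTrueTwins H →
    (DiamAtMost2 G ⊎ (NoIsolated G × NoIsolated H)) →
    IsCGraph (complement G) →
    ∀ w w' → IsCliqueNumber G w → IsCliqueNumber H w' →
    IsStrongMetricDim (G ⊕ H) (n * n' ∸ w * w')
mainTheorem7 G H 2≤n twinFreeG twinFreeH diameter complementC w w′ ωG ωH =
  let (a , a≤w , c , proper) = complement-CGraph⇒colouring G complementC ωG
  in strongMetricDim-Diameter≤2 (G ⊕ H) (⊕-Diameter≤2 G H noIsolatedG diameter′)
       (⊕-NoTrueTwins G H twinFreeG twinFreeH) (⊕-cliqueNumber G H proper a≤w ωG ωH)
  where
  noIsolatedG : NoIsolated G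
  noIsolatedG = [ DiamAtMost2⇒NoIsolated G 2≤n , proj₁ ]′ diameter
  diameter′ : Diameter≤2 G ⊎ NoIsolated H
  diameter′ = Sum.map (DiamAtMost2⇒Diameter≤2 G) proj₂ diameter
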